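{- Let $\mathcal{F}$ be the M-NAE version of a set $\mathcal{C}$ of 3-literal clauses, and let $N=|U_3|$. The following are equivalent: (i) $t_{NAE}(\mathcal{F})=\frac{2(N-1)}{5}$; (ii) $t_s(\mathcal{F})=\frac{2(N-1)}{5}$; (iii) $mfvs(G^\triangleleft(\mathcal{F}))=\frac{2(N-1)}{5}$; (iv) $amfvs(G^\triangleleft(\mathcal{F}))=\frac{2(N-1)}{5}$.
   Context: The clauses. Let $X=\{x_1,\dots,x_n\}$ and let $\mathcal{C}=\{C_1,\dots,C_m\}$. Each clause involves three distinct variables and is written $C_r=(l_i\vee l_j\vee l_k)$ with $i<j<k$ and $l_u\in\{x_u,\overline{x_u}\}$. The variables. Let $U_2=\{y_1,\dots,y_n,w_1,\dots,w_m,z\}$ and $U_3=\{z\}\cup\bigcup_{g\in U_2\setminus\{z\}}\{\alpha_g,\beta_g,a_g,b_g,c_g\}$. The M-NAE version $\mathcal{F}$ is the following set of monotone clauses over $U_3$, with literal order as written: - for each $C_r$, the clauses $(\gamma_i\vee\gamma_j\vee\alpha_{w_r})$ and $(\beta_{w_r}\vee\gamma_k\vee z)$, where $\gamma_u=\alpha_{y_u}$ if $l_u=x_u$ and $\gamma_u=\beta_{y_u}$ if $l_u=\overline{x_u}$; - for each $g\in U_2\setminus\{z\}$, the clauses $(\alpha_g\vee\beta_g\vee a_g)$, $(\alpha_g\vee\beta_g\vee b_g)$, $(\alpha_g\vee\beta_g\vee c_g)$ and $(a_g\vee b_g\vee c_g)$. The representative graph $G^\triangleleft(\mathcal{F})$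 has vertex set $U_3$ and an arc $uv$ iff some clause $(p\vee q\vee r)$ of $\mathcal{F}$, in the written order, has $(u,v)\in\{(p,q),(q,r),(r,p)\}$. The quantities involved: - $t_s(\mathcal{F})$ is the minimum number of true variables in a standard truth assignment, one making every clause contain a true literal. - $t_{NAE}(\mathcal{F})$ is the minimum number of true variables in a NAE truth assignment, one making every clause contain both a true and a false literal; if none exists, it is $N+1$. - A feedback vertex set of a digraph $G=(V,E)$ is a set $S\subsetneq V$ meeting every directed cycle, and $mfvs(G)$ is its minimum size. - $amfvs(G)$ is the minimum size of a feedback vertex set $S$ with $G[S]$ acyclic. -}

module Defs where

open import Data.Nat using (ℕ; zero; suc; _+_; _*_; _∸_; _≤_)
open import Data.Nat.DivMod using (_/_)
open import Data.Bool using (Bool; true; false; _∨_; T; not)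
open import Data.Fin using (Fin; _<_; _↑ˡ_; _↑ʳ_; combine) renaming (zero to fz; suc to fs)
open import Data.Unit using () renaming (⊤ to Unit)
open import Data.Fin.Subset using (Subset; _∈_; _∉_; ∣_∣)
open import Data.Vec using (Vec; lookup; toList)
open import Data.List using (List; []; _∷_; _++_; concatMap; allFin; length)
open import Data.List.Relation.Unary.All using (All)
open import Data.List.Relation.Unary.Any using (Any)
open import Data.List.Relation.Unary.Unique.Propositional using (Unique)
open import Data.Product using (Σ; ∃; _×_; _,_)
open import Data.Sum using (_⊎_)
open import Relation.Binary.PropositionalEquality using (_≡_)
open import Relation.Nullary using (¬_)

-- Input: a set C = {C_1,…,C_m} of 3-literal clauses over x_1,…,x_n.
-- A clause (l_i ∨ l_j ∨ l_k) with i < j < k; the sign is true iff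
-- l_u = x_u (positive) and false iff l_u = ¬x_u.

record Clause3 (n : ℕ) : Set where
  field
    i j k    : Fin n
    i<j      : i < j
    j<k      : j < k
    si sj sk : Bool

-- The variable set U_3, encoded as Fin N with N = 1 + 5(n+m):
--   index 0 is z;
--   g ∈ U_2 \ {z} is encoded as Fin (n + m): y_u = u ↑ˡ m, w_r = n ↑ʳ r;
--   the five variables α_g, β_g, a_g, b_g, c_g are slots 0..4,
--   placed at index 1 + 5·g + slot.

NU3 : ℕ → ℕ → ℕ
NU3 n m = suc ((n + m) * 5)

module _ {n m : ℕ} where

  G2 : Set
  G2 = Fin (n + m)

  yv : Fin n → G2
  yv u = u ↑ˡ m

  wv : Fin m → G2
  wv r = n ↑ʳ r

  V : Set
  V = Fin (NU3 n m)

  zV : V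
  zV = fz

  slot : G2 → Fin 5 → V
  slot g s = fs (combine g s)

  αv βv av bv cv : G2 → V
  αv g = slot g (fz)
  βv g = slot g (fs fz)
  av g = slot g (fs (fs fz))
  bv g = slot g (fs (fs (fs fz)))
  cv g = slot g (fs (fs (fs (fs fz))))

  γ : Fin n → Bool → V
  γ u true  = αv (yv u)
  γ u false = βv (yv u)

  -- a monotone 3-clause (p ∨ q ∨ r), in written order
  MClause : Set
  MClause = V × V × V

  clausesOfC : Fin m → Clause3 n → List MClause
  clausesOfC r C =
      (γ i si , γ j sj , αv (wv r))
    ∷ (βv (wv r) , γ k sk , zV)
    ∷ []
    where open Clause3 C

  gadget : G2 → List MClause
  gadget g =
      (αv g , βv g , av g)
    ∷ (αv g , βv g , bv g)
    ∷ (αv g , βv g , cv g)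
    ∷ (av g , bv g , cv g)
    ∷ []

  MNAE : Vec (Clause3 n) m → List MClause
  MNAE Cs =
       concatMap (λ r → clausesOfC r (lookup Cs r)) (allFin m)
    ++ concatMap gadget (allFin (n + m))

-- Truth assignments: a subset of U_3 (the set of true variables).

Assignment : ℕ → Set
Assignment N = Subset N

holds : ∀ {N} → Assignment N → Fin N → Bool
holds s x = lookup s x

StdSat : ∀ {N} → Assignment N → Fin N × Fin N × Fin N → Set
StdSat s (p , q , r) = T (holds s p ∨ holds s q ∨ holds s r)

NAESat : ∀ {N} → Assignment N → Fin N × Fin N × Fin N → Set
NAESat s (p , q , r) =
  T (holds s p ∨ holds s q ∨ holds s r) ×
  T (not (holds s p) ∨ not (holds s q) ∨ not (holds s r))

IsMinSize : ∀ {N} → (Subset N → Set) → ℕ → Set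
IsMinSize {N} P k = (Σ (Subset N) λ S → P S × ∣ S ∣ ≡ k)
                  × (∀ S → P S → k ≤ ∣ S ∣)

TsIs : ∀ {N} → List (Fin N × Fin N × Fin N) → ℕ → Set
TsIs F k = IsMinSize (λ s → All (StdSat s) F) k

-- t_NAE(𝓕) = k  (with t_NAE = N+1 when no NAE assignment exists)
TNAEIs : ∀ {N} → List (Fin N × Fin N × Fin N) → ℕ → Set
TNAEIs {N} F k =
    IsMinSize (λ s → All (NAESat s) F) k
  ⊎ ((¬ Σ (Subset N) λ s → All (NAESat s) F) × k ≡ suc N)

Digraph : ℕ → Set₁
Digraph N = Fin N → Fin N → Set

arcsOf : ∀ {N} → Fin N × Fin N × Fin N → Fin N → Fin N → Set
arcsOf (p , q , r) u v =
  (u ≡ p × v ≡ q) ⊎ (u ≡ q × v ≡ r) ⊎ (u ≡ r × v ≡ p)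

repGraph : ∀ {N} → List (Fin N × Fin N × Fin N) → Digraph N
repGraph F u v = Any (λ c → arcsOf c u v) F

PathArcs : ∀ {N} → Digraph N → Fin N → List (Fin N) → Set
PathArcs G first []           = Unit
PathArcs G first (x ∷ [])     = G x first
PathArcs G first (x ∷ y ∷ xs) = G x y × PathArcs G first (y ∷ xs)

record Cycle {N : ℕ} (G : Digraph N) : Set where
  field
    v₀     : Fin N
    rest   : List (Fin N)
    unique : Unique (v₀ ∷ rest)
    arcs   : PathArcs G v₀ (v₀ ∷ rest)

cycleVerts : ∀ {N} {G : Digraph N} → Cycle G → List (Fin N)
cycleVerts c = Cycle.v₀ c ∷ Cycle.rest c

IsFVS : ∀ {N} → Digraph N → Subset N → Set
IsFVS {N} G S =
    (∃ λ (x : Fin N) → x ∉ S)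
  × (∀ (c : Cycle G) → Any (λ x → x ∈ S) (cycleVerts c))

InducedAcyclic : ∀ {N} → Digraph N → Subset N → Set
InducedAcyclic G S = ∀ (c : Cycle G) → ¬ All (λ x → x ∈ S) (cycleVerts c)

MfvsIs : ∀ {N} → Digraph N → ℕ → Set
MfvsIs G k = IsMinSize (IsFVS G) k

AmfvsIs : ∀ {N} → Digraph N → ℕ → Set
AmfvsIs G k = IsMinSize (λ S → IsFVS G S × InducedAcyclic G S) k

module Submission where

-- Here 2(N-1)/5 = 2(n+m), and each statement is shown equivalent to "C is
-- satisfiable", by one abstract pattern (minSize⇔) fed with three ingredients.
--  * Lower bound.  Each clause of F has three distinct variables, so it spans a directed
--    triangle of G◁(F) and every feedback vertex set is a standard assignment.  Each of the
--    n+m gadgets contains two true variables of a standard assignment.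
--  * Extraction.  A standard assignment of size exactly 2(n+m) has z false and exactly one
--    of α_g, β_g true in each gadget; resolving the two clauses of C_r then yields C_r.
--  * Witness.  A model of C yields a set S* of size 2(n+m) which is an NAE assignment;
--    rank functions rising along all arcs inside S*, resp. inside its complement, show that
--    both induce acyclic subgraphs, so S* is a feedback vertex set with G[S*] acyclic.

open import Defs
open import Data.Nat using (ℕ; zero; suc; _+_; _*_; _∸_; _≤_; _<_; z≤n; s≤s)
open import Data.Nat.Properties
open import Data.Nat.DivMod using (_/_; m*n/n≡m)
open import Data.Bool using (Bool; true; false; _∨_; _∧_; not; T; if_then_else_)
open import Data.Bool.Properties using (¬-not)
open import Data.Unit using (tt)
open import Data.Fin using (Fin; toℕ; combine; remQuot; splitAt) renaming (zero to fz; suc to fs)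
open import Data.Fin.Properties using (remQuot-combine; splitAt-↑ˡ; splitAt-↑ʳ; toℕ<n)
import Data.Fin.Properties as Fin
open import Data.Fin.Subset using (Subset; _∈_; _∉_; ∣_∣)
open import Data.Fin.Subset.Properties using (_∈?_)
open import Data.Vec using (Vec; []; _∷_; _++_; lookup; tabulate)
open import Data.Vec.Properties using (lookup∘tabulate; tabulate-cong; []=⇒lookup; lookup⇒[]=)
open import Data.List using (List; []; _∷_)
open import Data.List.Relation.Unary.All as All using (All; []; _∷_)
open import Data.List.Relation.Unary.All.Properties
  using (++⁺; ++⁻ˡ; ++⁻ʳ; concat⁺; concat⁻; map⁺; map⁻; tabulate⁺; tabulate⁻; ¬Any⇒All¬)
open import Data.List.Relation.Unary.Any as Any using (Any; here; there; any?)
import Data.List.Relation.Unary.Any.Properties as AnyP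
open import Data.List.Relation.Unary.AllPairs using ([]; _∷_)
open import Data.Product using (Σ; _×_; _,_; proj₁; proj₂; map; map₁; map₂)
open import Data.Sum using (_⊎_; inj₁; inj₂)
open import Data.Empty using (⊥-elim)
open import Function using (_∘_; id)
open import Function.Bundles using (_⇔_; mk⇔)
import Function.Properties.Equivalence as ⇔
open import Relation.Binary.PropositionalEquality
open import Relation.Nullary using (¬_; yes; no; contradiction)

Triple : Set → Set
Triple A = A × A × A

map3 : ∀ {A B : Set} → (A → B) → Triple A → Triple B
map3 f (p , q , r) = f p , f q , f r

triple-≡ : ∀ {A : Set} {a b c a′ b′ c′ : A} → a ≡ a′ → b ≡ b′ → c ≡ c′ → (a , b , c) ≡ (a′ , b′ , c′)
triple-≡ refl refl refl = refl

Sat3 NAE3 : Triple Bool → Set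
Sat3 (a , b , c) = T (a ∨ b ∨ c)
NAE3 (a , b , c) = T (a ∨ b ∨ c) × T (not a ∨ not b ∨ not c)

NAE-cong : ∀ {A : Set} {κ κ′ : A → Bool} → (∀ v → κ v ≡ κ′ v) → ∀ c → NAE3 (map3 κ c) → NAE3 (map3 κ′ c)
NAE-cong eq (p , q , r) = subst NAE3 (triple-≡ (eq p) (eq q) (eq r))

∨₃-intro : ∀ a b c → Any (_≡ true) (a ∷ b ∷ c ∷ []) → Sat3 (a , b , c)
∨₃-intro true  _     _     _ = tt
∨₃-intro false true  _     _ = tt
∨₃-intro false false true  _ = tt
∨₃-intro false false false (here ())
∨₃-intro false false false (there (here ()))
∨₃-intro false false false (there (there (here ())))

minSize⇔ : ∀ {N} {P Q : Subset N → Set} {H : Set} {k : ℕ} →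
           (∀ S → P S → Q S) → (∀ S → Q S → k ≤ ∣ S ∣) →
           (H → Σ (Subset N) λ S → P S × ∣ S ∣ ≡ k) →
           (∀ S → Q S → ∣ S ∣ ≡ k → H) →
           IsMinSize P k ⇔ H
minSize⇔ P⇒Q lower witness extract = mk⇔
  (λ { ((S , pS , size) , _) → extract S (P⇒Q S pS) size })
  (λ h → witness h , λ S pS → lower S (P⇒Q S pS))

-- t_NAE uses the value N + 1 for "no NAE assignment", so a value k ≤ N of t_NAE is
-- an attained minimum.
tNAE-attained : ∀ {N} {F : List (Triple (Fin N))} {k : ℕ} → k ≤ N →
                TNAEIs F k ⇔ IsMinSize (λ s → All (NAESat s) F) k
tNAE-attained {N} {F} {k} k≤N = mk⇔ attained inj₁
  where
  attained : TNAEIs F k → IsMinSize (λ s → All (NAESat s) F) k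
  attained (inj₁ minimum) = minimum
  attained (inj₂ (_ , refl)) = ⊥-elim (1+n≰n k≤N)

via : ∀ {A B H : Set} → A ⇔ H → B ⇔ H → A ⇔ B
via A⇔H B⇔H = ⇔.trans A⇔H (⇔.sym B⇔H)

-- Rank functions certify acyclicity: if ρ strictly increases along every arc of G
-- between P-vertices, then along a path of P-vertices closing at `first`, the rank
-- of the starting vertex is below that of `first` ...
module _ {N : ℕ} {G : Digraph N} (P : Fin N → Set) (ρ : Fin N → ℕ)
         (rises : ∀ {u v} → G u v → P u → P v → ρ u < ρ v) where

  rank-rises-along : ∀ first x xs → P first → All P (x ∷ xs) →
                     PathArcs G first (x ∷ xs) → ρ x < ρ first
  rank-rises-along first x [] Pfirst (Px ∷ []) arc = rises arc Px Pfirst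
  rank-rises-along first x (y ∷ xs) Pfirst (Px ∷ Pys) (arc , arcs) =
    <-trans (rises arc Px (All.head Pys)) (rank-rises-along first y xs Pfirst Pys arcs)

  no-cycle-inside : (c : Cycle G) → ¬ All P (cycleVerts c)
  no-cycle-inside c Pc = <-irrefl refl
    (rank-rises-along (Cycle.v₀ c) (Cycle.v₀ c) (Cycle.rest c) (All.head Pc) Pc (Cycle.arcs c))

-- Rises b κp κq κr ρp ρq ρr: along each arc of the triangle p → q → r → p whose two
-- ends both have colour b, the rank strictly increases.
Rises : Bool → Bool → Bool → Bool → ℕ → ℕ → ℕ → Set
Rises b κp κq κr ρp ρq ρr =
    (κp ≡ b → κq ≡ b → ρp < ρq)
  × (κq ≡ b → κr ≡ b → ρq < ρr)
  × (κr ≡ b → κp ≡ b → ρr < ρp)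

RisesOn : ∀ {A : Set} → (A → Bool) → Bool → (A → ℕ) → Triple A → Set
RisesOn κ b ρ (p , q , r) = Rises b (κ p) (κ q) (κ r) (ρ p) (ρ q) (ρ r)

Rises-cong : ∀ {b κp κq κr ρp ρq ρr κp′ κq′ κr′ ρp′ ρq′ ρr′} →
             κp ≡ κp′ → κq ≡ κq′ → κr ≡ κr′ → ρp ≡ ρp′ → ρq ≡ ρq′ → ρr ≡ ρr′ →
             Rises b κp′ κq′ κr′ ρp′ ρq′ ρr′ → Rises b κp κq κr ρp ρq ρr
Rises-cong refl refl refl refl refl refl rises = rises

class-acyclic : ∀ {N} (F : List (Triple (Fin N))) (κ : Fin N → Bool) (b : Bool) (ρ : Fin N → ℕ) →
                All (RisesOn κ b ρ) F →
                (c : Cycle (repGraph F)) → ¬ All (λ v → κ v ≡ b) (cycleVerts c)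
class-acyclic F κ b ρ rising = no-cycle-inside (λ v → κ v ≡ b) ρ rises-along-arc
  where
  arc-rises : ∀ {u v} c → RisesOn κ b ρ c → arcsOf c u v → κ u ≡ b → κ v ≡ b → ρ u < ρ v
  arc-rises c (pq , _ , _) (inj₁ (refl , refl)) = pq
  arc-rises c (_ , qr , _) (inj₂ (inj₁ (refl , refl))) = qr
  arc-rises c (_ , _ , rp) (inj₂ (inj₂ (refl , refl))) = rp

  rises-along-arc : ∀ {u v} → repGraph F u v → κ u ≡ b → κ v ≡ b → ρ u < ρ v
  rises-along-arc {u} {v} arc κu κv =
    All.lookupWith {R = λ _ → ρ u < ρ v} (λ {c} rc a → arc-rises c rc a κu κv) rising arc

Distinct3 : ∀ {A : Set} → Triple A → Set
Distinct3 (p , q , r) = ¬ p ≡ q × ¬ q ≡ r × ¬ p ≡ r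

distinct-reflect : ∀ {A B : Set} (f : A → B) (c : Triple A) → Distinct3 (map3 f c) → Distinct3 c
distinct-reflect f (p , q , r) (p≢q , q≢r , p≢r) =
  (λ e → p≢q (cong f e)) , (λ e → q≢r (cong f e)) , (λ e → p≢r (cong f e))

-- A clause with three distinct variables spans a directed triangle of G^◁(F); a
-- feedback vertex set meets it, hence is a standard truth assignment for F.
fvs⇒standard : ∀ {N} (F : List (Triple (Fin N))) → All Distinct3 F →
               ∀ S → IsFVS (repGraph F) S → All (StdSat S) F
fvs⇒standard F distinct S (_ , hits) = All.tabulate clause-hit
  where
  clause-hit : ∀ {c} → Any (c ≡_) F → StdSat S c
  clause-hit {p , q , r} c∈F with All.lookup distinct c∈F
  ... | p≢q , q≢r , p≢r = ∨₃-intro _ _ _ (AnyP.map⁺ (Any.map []=⇒lookup (hits triangle)))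
    where
    arc : ∀ {u v} → arcsOf (p , q , r) u v → repGraph F u v
    arc a = Any.map (λ { refl → a }) c∈F

    triangle : Cycle (repGraph F)
    triangle = record
      { v₀ = p ; rest = q ∷ r ∷ []
      ; unique = (p≢q ∷ p≢r ∷ []) ∷ (q≢r ∷ []) ∷ [] ∷ []
      ; arcs = arc (inj₁ (refl , refl)) , arc (inj₂ (inj₁ (refl , refl))) , arc (inj₂ (inj₂ (refl , refl))) }

∣++∣ : ∀ {a b} (p : Subset a) (q : Subset b) → ∣ p ++ q ∣ ≡ ∣ p ∣ + ∣ q ∣
∣++∣ [] q = refl
∣++∣ (true ∷ p) q = cong suc (∣++∣ p q)
∣++∣ (false ∷ p) q = ∣++∣ p q

∑ : (M : ℕ) → (Fin M → ℕ) → ℕ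
∑ zero f = 0
∑ (suc M) f = f fz + ∑ M (f ∘ fs)

∑-const : ∀ M {c} (f : Fin M → ℕ) → (∀ g → f g ≡ c) → ∑ M f ≡ M * c
∑-const zero f eq = refl
∑-const (suc M) f eq = cong₂ _+_ (eq fz) (∑-const M (f ∘ fs) (eq ∘ fs))

∑-lower : ∀ M {c} (f : Fin M → ℕ) → (∀ g → c ≤ f g) → M * c ≤ ∑ M f
∑-lower zero f low = z≤n
∑-lower (suc M) f low = +-mono-≤ (low fz) (∑-lower M (f ∘ fs) (low ∘ fs))

∑-tight : ∀ M {c} (f : Fin M → ℕ) → (∀ g → c ≤ f g) → ∑ M f ≤ M * c → ∀ g → f g ≤ c
∑-tight (suc M) {c} f low total fz =
  +-cancelʳ-≤ (M * c) (f fz) c (≤-trans (+-monoʳ-≤ (f fz) (∑-lower M (f ∘ fs) (low ∘ fs))) total)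
∑-tight (suc M) {c} f low total (fs g) =
  ∑-tight M (f ∘ fs) (low ∘ fs) (+-cancelˡ-≤ c _ _ (≤-trans (+-monoˡ-≤ (∑ M (f ∘ fs)) (low fz)) total)) g

block : ∀ {M} → Subset (M * 5) → Fin M → Subset 5
block S g = tabulate (λ s → lookup S (combine g s))

∣∣-blocks : ∀ M (S : Subset (M * 5)) → ∣ S ∣ ≡ ∑ M (λ g → ∣ block S g ∣)
∣∣-blocks zero [] = refl
∣∣-blocks (suc M) (a ∷ b ∷ c ∷ d ∷ e ∷ S) =
  trans (∣++∣ (a ∷ b ∷ c ∷ d ∷ e ∷ []) S) (cong (∣ a ∷ b ∷ c ∷ d ∷ e ∷ [] ∣ +_) (∣∣-blocks M S))

sα sβ sa sb sc : Fin 5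
sα = fz
sβ = fs fz
sa = fs (fs fz)
sb = fs (fs (fs fz))
sc = fs (fs (fs (fs fz)))

OnGadget : ∀ {A : Set} → (Triple A → Set) → (Fin 5 → A) → Set
OnGadget Q f = Q (f sα , f sβ , f sa) × Q (f sα , f sβ , f sb)
             × Q (f sα , f sβ , f sc) × Q (f sa , f sb , f sc)

gadget-lower : (f : Fin 5 → Bool) → OnGadget Sat3 f → 2 ≤ ∣ tabulate f ∣
gadget-lower f = lower (f sα) (f sβ) (f sa) (f sb) (f sc)
  where
  lower : ∀ α β a b c → OnGadget Sat3 (lookup (α ∷ β ∷ a ∷ b ∷ c ∷ [])) →
          2 ≤ ∣ α ∷ β ∷ a ∷ b ∷ c ∷ [] ∣
  lower true  true  _     _     _     _ = s≤s (s≤s z≤n)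
  lower true  false true  _     _     _ = s≤s (s≤s z≤n)
  lower true  false false true  _     _ = s≤s (s≤s z≤n)
  lower true  false false false true  _ = s≤s (s≤s z≤n)
  lower false true  true  _     _     _ = s≤s (s≤s z≤n)
  lower false true  false true  _     _ = s≤s (s≤s z≤n)
  lower false true  false false true  _ = s≤s (s≤s z≤n)
  lower false false true  true  true  _ = s≤s (s≤s z≤n)
  lower true  false false false false (_ , _ , _ , ())
  lower false true  false false false (_ , _ , _ , ())
  lower false false false _     _     (() , _)
  lower false false true  false _     (_ , () , _)
  lower false false true  true  false (_ , _ , () , _)

gadget-tight : (f : Fin 5 → Bool) → OnGadget Sat3 f → ∣ tabulate f ∣ ≤ 2 → f sβ ≡ not (f sα)
gadget-tight f = tight (f sα) (f sβ) (f sa) (f sb) (f sc)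
  where
  tight : ∀ α β a b c → OnGadget Sat3 (lookup (α ∷ β ∷ a ∷ b ∷ c ∷ [])) →
          ∣ α ∷ β ∷ a ∷ b ∷ c ∷ [] ∣ ≤ 2 → β ≡ not α
  tight true  false _     _     _     _ _ = refl
  tight false true  _     _     _     _ _ = refl
  tight true  true  true  _     _     _ (s≤s (s≤s ()))
  tight true  true  false true  _     _ (s≤s (s≤s ()))
  tight true  true  false false true  _ (s≤s (s≤s ()))
  tight true  true  false false false (_ , _ , _ , ()) _
  tight false false true  true  true  _ (s≤s (s≤s ()))
  tight false false false _     _     (() , _) _
  tight false false true  false _     (_ , () , _) _
  tight false false true  true  false (_ , _ , () , _) _

-- In the witness, α_{w_r} is true iff l_k holds and l_i, l_j do not both hold; then both
-- (l_i, l_j, α_{w_r}) and (¬α_{w_r}, l_k, z = false) are not-all-equal.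
choose : Bool → Bool → Bool → Bool
choose a b c = not (a ∧ b) ∧ c

clause-nae : ∀ a b c → Sat3 (a , b , c) →
             NAE3 (a , b , choose a b c) × NAE3 (not (choose a b c) , c , false)
clause-nae true  true  true  _ = (tt , tt) , (tt , tt)
clause-nae true  true  false _ = (tt , tt) , (tt , tt)
clause-nae true  false true  _ = (tt , tt) , (tt , tt)
clause-nae true  false false _ = (tt , tt) , (tt , tt)
clause-nae false true  true  _ = (tt , tt) , (tt , tt)
clause-nae false true  false _ = (tt , tt) , (tt , tt)
clause-nae false false true  _ = (tt , tt) , (tt , tt)

gadgetPattern : Bool → Fin 5 → Bool
gadgetPattern p = lookup (p ∷ not p ∷ true ∷ false ∷ false ∷ [])

gadgetPattern-size : ∀ p → ∣ tabulate (gadgetPattern p) ∣ ≡ 2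
gadgetPattern-size true = refl
gadgetPattern-size false = refl

gadget-nae : ∀ p → OnGadget (NAE3 ∘ map3 (gadgetPattern p)) id
gadget-nae true  = (tt , tt) , (tt , tt) , (tt , tt) , (tt , tt)
gadget-nae false = (tt , tt) , (tt , tt) , (tt , tt) , (tt , tt)

-- Ranks certifying that the false variables of the witness induce an acyclic subgraph.
-- Inside a gadget with base t: α, β get 2+t; b, c lie above β when β is false and
-- below α when α is false.
falseRank : Bool → ℕ → Fin 5 → ℕ
falseRank p t = lookup (2 + t ∷ 2 + t ∷ 0 ∷ (if p then 3 + t else 0) ∷ (if p then 4 + t else 1) ∷ [])

gadget-rises-false : ∀ p t → OnGadget (RisesOn (gadgetPattern p) false (falseRank p t)) id
gadget-rises-false true t =
    ((λ ()) , (λ _ ()) , (λ ()))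
  , ((λ ()) , (λ _ _ → n<1+n (2 + t)) , (λ _ ()))
  , ((λ ()) , (λ _ _ → <-trans (n<1+n (2 + t)) (n<1+n (3 + t))) , (λ _ ()))
  , ((λ ()) , (λ _ _ → n<1+n (3 + t)) , (λ _ ()))
gadget-rises-false false t =
    ((λ _ ()) , (λ ()) , (λ ()))
  , ((λ _ ()) , (λ ()) , (λ _ _ → s≤s z≤n))
  , ((λ _ ()) , (λ ()) , (λ _ _ → s≤s (s≤s z≤n)))
  , ((λ ()) , (λ _ _ → s≤s z≤n) , (λ _ ()))

-- Ranks certifying that the true variables of the witness induce an acyclic subgraph:
-- α, β get 1+t; a lies below α when α is true and above β when β is true.
trueRank : Bool → ℕ → Fin 5 → ℕ
trueRank p t = lookup (1 + t ∷ 1 + t ∷ (if p then 0 else 2 + t) ∷ 0 ∷ 0 ∷ [])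

gadget-rises-true : ∀ p t → OnGadget (RisesOn (gadgetPattern p) true (trueRank p t)) id
gadget-rises-true true t =
    ((λ _ ()) , (λ ()) , (λ _ _ → s≤s z≤n))
  , ((λ _ ()) , (λ ()) , (λ ()))
  , ((λ _ ()) , (λ ()) , (λ ()))
  , ((λ _ ()) , (λ ()) , (λ ()))
gadget-rises-true false t =
    ((λ ()) , (λ _ _ → n<1+n (1 + t)) , (λ _ ()))
  , ((λ ()) , (λ _ ()) , (λ ()))
  , ((λ ()) , (λ _ ()) , (λ ()))
  , ((λ _ ()) , (λ ()) , (λ ()))

wBaseF : ℕ → Bool → Bool → Bool → ℕ
wBaseF n a b c = if a ∨ choose a b c then 2 + n else 0

wBaseT : ℕ → Bool → ℕ
wBaseT n a = if a then 0 else 2 + n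

-- The two clauses of a satisfied C_r rise in the false class, when the literal l_u has
-- rank 3 + u, α_{w_r} and β_{w_r} have rank 2 + wBaseF and z has rank 3 + n.
clause-rises-false : ∀ {n i j k} a b c → i < j → j < n → k < n → Sat3 (a , b , c) →
    Rises false a b (choose a b c) (3 + i) (3 + j) (2 + wBaseF n a b c)
  × Rises false (not (choose a b c)) c false (2 + wBaseF n a b c) (3 + k) (3 + n)
clause-rises-false {n} {i} {j} {k} a b c i<j j<n k<n sat =
    ((λ _ _ → +-monoʳ-< 3 i<j) , lj→αw a b c sat , αw→li a b c sat)
  , (βw→lk a b c , (λ _ _ → +-monoʳ-< 3 k<n) , λ _ → z→βw a b c)
  where
  -- l_j and α_w both false force l_i true
  lj→αw : ∀ a b c → Sat3 (a , b , c) → b ≡ false → choose a b c ≡ false → 3 + j < 2 + wBaseF n a b c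
  lj→αw true  false c     _ _ _ = +-monoʳ-≤ 4 (<⇒≤ j<n)
  lj→αw false false true  _ _ ()
  lj→αw false false false () _ _
  -- α_w and l_i both false force l_j true and l_k false
  αw→li : ∀ a b c → Sat3 (a , b , c) → choose a b c ≡ false → a ≡ false → 2 + wBaseF n a b c < 3 + i
  αw→li false true  false _ _ _ = s≤s (s≤s (s≤s z≤n))
  αw→li false true  true  _ () _
  αw→li false false true  _ () _
  αw→li false false false () _ _
  -- β_w false means α_w true, which forces l_k true
  βw→lk : ∀ a b c → not (choose a b c) ≡ false → c ≡ false → 2 + wBaseF n a b c < 3 + k
  βw→lk a     b     true  _  ()
  βw→lk true  true  false () _
  βw→lk true  false false () _
  βw→lk false b     false () _
  -- β_w false means α_w true, so β_w has the high rank
  z→βw : ∀ a b c → not (choose a b c) ≡ false → 3 + n < 2 + wBaseF n a b c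
  z→βw true  false true  _ = n<1+n (3 + n)
  z→βw false b     true  _ = n<1+n (3 + n)
  z→βw true  true  true  ()
  z→βw true  true  false ()
  z→βw true  false false ()
  z→βw false b     false ()

-- The two clauses of C_r rise in the true class (whether or not C_r is satisfied), when the literal l_u has
-- rank 2 + u, α_{w_r} and β_{w_r} have rank 1 + wBaseT and z (never true) rank 0.
clause-rises-true : ∀ {n i j k} a b c → i < j → j < n →
    Rises true a b (choose a b c) (2 + i) (2 + j) (1 + wBaseT n a)
  × Rises true (not (choose a b c)) c false (1 + wBaseT n a) (2 + k) 0
clause-rises-true {n} {i} {j} {k} a b c i<j j<n =
    ((λ _ _ → +-monoʳ-< 2 i<j) , lj→αw a b c , αw→li a)
  , (βw→lk a b c , (λ _ ()) , λ ())
  where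
  -- l_j and α_w both true force l_i false
  lj→αw : ∀ a b c → b ≡ true → choose a b c ≡ true → 2 + j < 1 + wBaseT n a
  lj→αw false true c _ _ = +-monoʳ-≤ 3 (<⇒≤ j<n)
  lj→αw true  true c _ ()
  -- l_i true gives α_w the low rank
  αw→li : ∀ a → choose a b c ≡ true → a ≡ true → 1 + wBaseT n a < 2 + i
  αw→li true _ _ = s≤s (s≤s z≤n)
  -- β_w and l_k both true force l_i (and l_j) true
  βw→lk : ∀ a b c → not (choose a b c) ≡ true → c ≡ true → 1 + wBaseT n a < 2 + k
  βw→lk true  true  true _ _ = s≤s (s≤s z≤n)
  βw→lk true  false true () _
  βw→lk false b     true () _

resolve : ∀ a b c α → Sat3 (a , b , α) → Sat3 (not α , c , false) → Sat3 (a , b , c)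
resolve true  _     _     _     _ _  = tt
resolve false true  _     _     _ _  = tt
resolve false false true  true  _ _  = tt
resolve false false false true  _ ()
resolve false false _     false () _

literal : ∀ {n} → (Fin n → Bool) → Fin n → Bool → Bool
literal x u s = if s then x u else not (x u)

Satisfies : ∀ {n} → (Fin n → Bool) → Clause3 n → Set
Satisfies x cl = Sat3 (literal x i si , literal x j sj , literal x k sk)
  where open Clause3 cl

module Reduction (n m : ℕ) (C : Vec (Clause3 n) m) where

  M : ℕ
  M = n + m

  F : List (MClause {n} {m})
  F = MNAE C

  Satisfiable : Set
  Satisfiable = Σ (Fin n → Bool) λ x → ∀ r → Satisfies x (lookup C r)

  data Var : Set where
    vz : Var
    vy : Fin n → Fin 5 → Var
    vw : Fin m → Fin 5 → Var

  gadgetVar : Fin n ⊎ Fin m → Fin 5 → Var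
  gadgetVar (inj₁ u) = vy u
  gadgetVar (inj₂ r) = vw r

  decodeSlot : Fin M × Fin 5 → Var
  decodeSlot (g , s) = gadgetVar (splitAt n g) s

  decode : V {n} {m} → Var
  decode fz = vz
  decode (fs v) = decodeSlot (remQuot 5 v)

  decode-slot : ∀ g s → decode (slot {n} {m} g s) ≡ gadgetVar (splitAt n g) s
  decode-slot g s = cong decodeSlot (remQuot-combine g s)

  litSlot : Bool → Fin 5
  litSlot true = sα
  litSlot false = sβ

  decode-y : ∀ u s → decode (slot {n} {m} (yv {n} {m} u) s) ≡ vy u s
  decode-y u s = trans (decode-slot (yv {n} {m} u) s) (cong (λ e → gadgetVar e s) (splitAt-↑ˡ n u m))

  decode-γ : ∀ u s → decode (γ {n} {m} u s) ≡ vy u (litSlot s)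
  decode-γ u true = decode-y u sα
  decode-γ u false = decode-y u sβ

  decode-w : ∀ r s → decode (slot {n} {m} (wv {n} {m} r) s) ≡ vw r s
  decode-w r s = trans (decode-slot (wv {n} {m} r) s) (cong (λ e → gadgetVar e s) (splitAt-↑ʳ n m r))

  clause₁ clause₂ : Fin m → Triple Var
  clause₁ r = vy i (litSlot si) , vy j (litSlot sj) , vw r sα
    where open Clause3 (lookup C r)
  clause₂ r = vw r sβ , vy k (litSlot sk) , vz
    where open Clause3 (lookup C r)

  all-decoded : (Q : Triple Var → Set) → (∀ r → Q (clause₁ r)) → (∀ r → Q (clause₂ r)) →
                (∀ e → OnGadget Q (gadgetVar e)) → All (Q ∘ map3 decode) F
  all-decoded Q Q₁ Q₂ Qg =
    ++⁺ (concat⁺ (map⁺ (tabulate⁺ from-clause))) (concat⁺ (map⁺ (tabulate⁺ from-gadget)))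
    where
    from-clause : ∀ r → All (Q ∘ map3 decode) (clausesOfC {n} {m} r (lookup C r))
    from-clause r = subst Q (sym (triple-≡ (decode-γ i si) (decode-γ j sj) (decode-w r sα))) (Q₁ r)
                  ∷ subst Q (sym (triple-≡ (decode-w r sβ) (decode-γ k sk) refl)) (Q₂ r) ∷ []
      where open Clause3 (lookup C r)

    from-gadget : ∀ (g : Fin M) → All (Q ∘ map3 decode) (gadget {n} {m} g)
    from-gadget g with Qg (splitAt n g)
    ... | Qαβa , Qαβb , Qαβc , Qabc =
        on-slots sα sβ sa Qαβa ∷ on-slots sα sβ sb Qαβb ∷ on-slots sα sβ sc Qαβc ∷ on-slots sa sb sc Qabc ∷ []
      where
      on-slots : ∀ s t u → Q (map3 (gadgetVar (splitAt n g)) (s , t , u)) →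
                 Q (map3 decode (slot {n} {m} g s , slot {n} {m} g t , slot {n} {m} g u))
      on-slots s t u = subst Q (sym (triple-≡ (decode-slot g s) (decode-slot g t) (decode-slot g u)))

  clauses-of : ∀ {Q : MClause {n} {m} → Set} → All Q F →
               (∀ r → All Q (clausesOfC {n} {m} r (lookup C r))) × (∀ g → All Q (gadget {n} {m} g))
  clauses-of allQ = tabulate⁻ (map⁻ (concat⁻ (++⁻ˡ _ allQ))) , tabulate⁻ (map⁻ (concat⁻ (++⁻ʳ _ allQ)))

  F-distinct : All Distinct3 F
  F-distinct = All.map (λ {c} → distinct-reflect decode c) (all-decoded Distinct3 distinct₁ distinct₂ distinct-g)
    where
    vy-injective : ∀ {u u′ s s′} → vy u s ≡ vy u′ s′ → u ≡ u′
    vy-injective refl = refl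

    distinct₁ : ∀ r → Distinct3 (clause₁ r)
    distinct₁ r = (λ e → Fin.<⇒≢ i<j (vy-injective e)) , (λ ()) , (λ ())
      where open Clause3 (lookup C r)

    distinct₂ : ∀ r → Distinct3 (clause₂ r)
    distinct₂ r = (λ ()) , (λ ()) , (λ ())

    distinct-g : ∀ e → OnGadget Distinct3 (gadgetVar e)
    distinct-g (inj₁ u) = ((λ ()) , (λ ()) , (λ ())) , ((λ ()) , (λ ()) , (λ ()))
                        , ((λ ()) , (λ ()) , (λ ())) , ((λ ()) , (λ ()) , (λ ()))
    distinct-g (inj₂ r) = ((λ ()) , (λ ()) , (λ ())) , ((λ ()) , (λ ()) , (λ ()))
                        , ((λ ()) , (λ ()) , (λ ())) , ((λ ()) , (λ ()) , (λ ()))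

  gadget-clauses : ∀ h S → All (StdSat (h ∷ S)) F → ∀ (g : Fin M) → OnGadget Sat3 (λ s → lookup S (combine g s))
  gadget-clauses h S std g with proj₂ (clauses-of std) g
  ... | αβa ∷ αβb ∷ αβc ∷ abc ∷ [] = αβa , αβb , αβc , abc

  size-split : ∀ h S → ∣ h ∷ S ∣ ≡ ∣ h ∷ [] ∣ + ∑ M (λ g → ∣ block S g ∣)
  size-split h S = trans (∣++∣ (h ∷ []) S) (cong (∣ h ∷ [] ∣ +_) (∣∣-blocks M S))

  gadgets-lower : ∀ h S → All (StdSat (h ∷ S)) F → ∀ (g : Fin M) → 2 ≤ ∣ block S g ∣
  gadgets-lower h S std g = gadget-lower (λ s → lookup S (combine g s)) (gadget-clauses h S std g)

  standard-lower : ∀ S → All (StdSat S) F → M * 2 ≤ ∣ S ∣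
  standard-lower (h ∷ S) std = subst (M * 2 ≤_) (sym (size-split h S))
    (≤-trans (∑-lower M _ (gadgets-lower h S std)) (m≤n+m _ ∣ h ∷ [] ∣))

  -- A standard truth assignment with exactly 2(n+m) true variables has z false and exactly
  -- one of α_g, β_g true in every gadget; the values of the α_{y_u} then satisfy C, since
  -- resolving (l_i ∨ l_j ∨ α_{w_r}) with (β_{w_r} ∨ l_k ∨ z) gives C_r.
  standard-extract : ∀ S → All (StdSat S) F → ∣ S ∣ ≡ M * 2 → Satisfiable
  standard-extract (h ∷ S) std size = x , satisfied
    where
    blocks : ℕ
    blocks = ∑ M (λ g → ∣ block S g ∣)

    enough : M * 2 ≤ blocks
    enough = ∑-lower M _ (gadgets-lower h S std)

    exact : ∣ h ∷ [] ∣ + blocks ≡ M * 2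
    exact = trans (sym (size-split h S)) size

    z-false : ∀ b → ∣ b ∷ [] ∣ + blocks ≡ M * 2 → b ≡ false
    z-false false _ = refl
    z-false true e = ⊥-elim (1+n≰n (subst (_≤ blocks) (sym e) enough))

    opposite : ∀ (g : Fin M) → lookup S (combine g sβ) ≡ not (lookup S (combine g sα))
    opposite g = gadget-tight (λ s → lookup S (combine g s)) (gadget-clauses h S std g)
      (∑-tight M _ (gadgets-lower h S std) (subst (blocks ≤_) exact (m≤n+m blocks _)) g)

    x : Fin n → Bool
    x u = lookup S (combine (yv {n} {m} u) sα)

    γ-value : ∀ u s → holds (h ∷ S) (γ {n} {m} u s) ≡ literal x u s
    γ-value u true = refl
    γ-value u false = opposite (yv {n} {m} u)

    satisfied : ∀ r → Satisfies x (lookup C r)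
    satisfied r with proj₁ (clauses-of std) r
    ... | first ∷ second ∷ [] =
      subst Sat3 (triple-≡ (γ-value i si) (γ-value j sj) (γ-value k sk))
        (resolve (value (γ i si)) (value (γ j sj)) (value (γ k sk)) (value (αv {n} {m} (wv {n} {m} r))) first
          (subst₂ (λ β z → Sat3 (β , value (γ k sk) , z)) (opposite (wv {n} {m} r)) (z-false h exact) second))
      where
      open Clause3 (lookup C r)
      value : V {n} {m} → Bool
      value = holds (h ∷ S)

  -- From an assignment x satisfying C we build a set S* of 2(n+m) variables: z false, in the
  -- gadget of y_u the pattern of x_u, in the gadget of w_r the pattern of `choose`.  It is
  -- an NAE assignment, and ranks show that both S* and its complement induce acyclic
  -- subgraphs, so S* is a feedback vertex set with G[S*] acyclic.
  module Witness (x : Fin n → Bool) (sat : ∀ r → Satisfies x (lookup C r)) where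

    ℓᵢ ℓⱼ ℓₖ choice : Fin m → Bool
    ℓᵢ r = literal x i si where open Clause3 (lookup C r)
    ℓⱼ r = literal x j sj where open Clause3 (lookup C r)
    ℓₖ r = literal x k sk where open Clause3 (lookup C r)
    choice r = choose (ℓᵢ r) (ℓⱼ r) (ℓₖ r)

    member : Var → Bool
    member vz = false
    member (vy u s) = gadgetPattern (x u) s
    member (vw r s) = gadgetPattern (choice r) s

    rankF rankT : Var → ℕ
    rankF vz = 3 + n
    rankF (vy u s) = falseRank (x u) (1 + toℕ u) s
    rankF (vw r s) = falseRank (choice r) (wBaseF n (ℓᵢ r) (ℓⱼ r) (ℓₖ r)) s
    rankT vz = 0
    rankT (vy u s) = trueRank (x u) (1 + toℕ u) s
    rankT (vw r s) = trueRank (choice r) (wBaseT n (ℓᵢ r)) s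

    literal-member : ∀ u s → member (vy u (litSlot s)) ≡ literal x u s
    literal-member u true = refl
    literal-member u false = refl

    literal-rankF : ∀ u s → rankF (vy u (litSlot s)) ≡ 3 + toℕ u
    literal-rankF u true = refl
    literal-rankF u false = refl

    literal-rankT : ∀ u s → rankT (vy u (litSlot s)) ≡ 2 + toℕ u
    literal-rankT u true = refl
    literal-rankT u false = refl

    S* : Subset (NU3 n m)
    S* = tabulate (member ∘ decode)

    holds-S* : ∀ v → holds S* v ≡ member (decode v)
    holds-S* = lookup∘tabulate (member ∘ decode)

    S*-nae : All (NAESat S*) F
    S*-nae = All.map (λ {c} → NAE-cong (sym ∘ holds-S*) c)
      (all-decoded (NAE3 ∘ map3 member) (proj₁ ∘ clause-values) (proj₂ ∘ clause-values) gadget-values)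
      where
      clause-values : ∀ r → NAE3 (map3 member (clause₁ r)) × NAE3 (map3 member (clause₂ r))
      clause-values r = map (subst NAE3 (sym first)) (subst NAE3 (sym second))
                            (clause-nae (ℓᵢ r) (ℓⱼ r) (ℓₖ r) (sat r))
        where
        open Clause3 (lookup C r)
        first : map3 member (clause₁ r) ≡ (ℓᵢ r , ℓⱼ r , choice r)
        first = triple-≡ (literal-member i si) (literal-member j sj) refl
        second : map3 member (clause₂ r) ≡ (not (choice r) , ℓₖ r , false)
        second = triple-≡ refl (literal-member k sk) refl

      gadget-values : ∀ e → OnGadget (NAE3 ∘ map3 member) (gadgetVar e)
      gadget-values (inj₁ u) = gadget-nae (x u)
      gadget-values (inj₂ r) = gadget-nae (choice r)

    S*-size : ∣ S* ∣ ≡ M * 2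
    S*-size = trans (∣∣-blocks M rest) (∑-const M _ block-size)
      where
      rest : Subset (M * 5)
      rest = tabulate (member ∘ decode ∘ fs)

      block-size : ∀ g → ∣ block rest g ∣ ≡ 2
      block-size g = trans
        (cong ∣_∣ (tabulate-cong (λ s → trans (lookup∘tabulate (member ∘ decode ∘ fs) (combine g s)) (cong member (decode-slot g s)))))
        (pattern-size (splitAt n g))
        where
        pattern-size : ∀ e → ∣ tabulate (member ∘ gadgetVar e) ∣ ≡ 2
        pattern-size (inj₁ u) = gadgetPattern-size (x u)
        pattern-size (inj₂ r) = gadgetPattern-size (choice r)

    rises-false : All (RisesOn (member ∘ decode) false (rankF ∘ decode)) F
    rises-false = all-decoded (RisesOn member false rankF) (proj₁ ∘ clause-rises) (proj₂ ∘ clause-rises) gadget-rises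
      where
      clause-rises : ∀ r → RisesOn member false rankF (clause₁ r) × RisesOn member false rankF (clause₂ r)
      clause-rises r =
        map (Rises-cong (literal-member i si) (literal-member j sj) refl (literal-rankF i si) (literal-rankF j sj) refl)
            (Rises-cong refl (literal-member k sk) refl refl (literal-rankF k sk) refl)
            (clause-rises-false (ℓᵢ r) (ℓⱼ r) (ℓₖ r) i<j (toℕ<n j) (toℕ<n k) (sat r))
        where open Clause3 (lookup C r)

      gadget-rises : ∀ e → OnGadget (RisesOn member false rankF) (gadgetVar e)
      gadget-rises (inj₁ u) = gadget-rises-false (x u) (1 + toℕ u)
      gadget-rises (inj₂ r) = gadget-rises-false (choice r) (wBaseF n (ℓᵢ r) (ℓⱼ r) (ℓₖ r))

    rises-true : All (RisesOn (member ∘ decode) true (rankT ∘ decode)) F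
    rises-true = all-decoded (RisesOn member true rankT) (proj₁ ∘ clause-rises) (proj₂ ∘ clause-rises) gadget-rises
      where
      clause-rises : ∀ r → RisesOn member true rankT (clause₁ r) × RisesOn member true rankT (clause₂ r)
      clause-rises r =
        map (Rises-cong (literal-member i si) (literal-member j sj) refl (literal-rankT i si) (literal-rankT j sj) refl)
            (Rises-cong refl (literal-member k sk) refl refl (literal-rankT k sk) refl)
            (clause-rises-true (ℓᵢ r) (ℓⱼ r) (ℓₖ r) i<j (toℕ<n j))
        where open Clause3 (lookup C r)

      gadget-rises : ∀ e → OnGadget (RisesOn member true rankT) (gadgetVar e)
      gadget-rises (inj₁ u) = gadget-rises-true (x u) (1 + toℕ u)
      gadget-rises (inj₂ r) = gadget-rises-true (choice r) (wBaseT n (ℓᵢ r))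

    ∈S* : ∀ {v} → v ∈ S* → member (decode v) ≡ true
    ∈S* {v} v∈S* = trans (sym (holds-S* v)) ([]=⇒lookup v∈S*)

    ∉S* : ∀ {v} → v ∉ S* → member (decode v) ≡ false
    ∉S* {v} v∉S* = ¬-not (λ true-v → v∉S* (lookup⇒[]= v S* (trans (holds-S* v) true-v)))

    -- z ∉ S*, and a cycle avoiding S* would lie in the false class.
    S*-fvs : IsFVS (repGraph F) S*
    S*-fvs = (fz , λ z∈S* → contradiction (∈S* z∈S*) λ ()) , hits
      where
      hits : ∀ c → Any (_∈ S*) (cycleVerts c)
      hits c with any? (_∈? S*) (cycleVerts c)
      ... | yes hit = hit
      ... | no miss = ⊥-elim (class-acyclic F (member ∘ decode) false (rankF ∘ decode) rises-false c
                                (All.map ∉S* (¬Any⇒All¬ _ miss)))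

    S*-acyclic : InducedAcyclic (repGraph F) S*
    S*-acyclic c inside = class-acyclic F (member ∘ decode) true (rankT ∘ decode) rises-true c (All.map ∈S* inside)

  witness : Satisfiable → Σ (Subset (NU3 n m)) λ S →
            (All (NAESat S) F × IsFVS (repGraph F) S × InducedAcyclic (repGraph F) S) × ∣ S ∣ ≡ M * 2
  witness (x , sat) = S* , (S*-nae , S*-fvs , S*-acyclic) , S*-size
    where open Witness x sat

  witness-with : ∀ {P : Subset (NU3 n m) → Set} →
                 (∀ {S} → All (NAESat S) F × IsFVS (repGraph F) S × InducedAcyclic (repGraph F) S → P S) →
                 Satisfiable → Σ (Subset (NU3 n m)) λ S → P S × ∣ S ∣ ≡ M * 2
  witness-with property = map₂ (map₁ property) ∘ witness

  bound≤N : M * 2 ≤ NU3 n m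
  bound≤N = ≤-trans (*-monoʳ-≤ M (s≤s (s≤s z≤n))) (n≤1+n (M * 5))

  tNAE⇔ : TNAEIs F (M * 2) ⇔ Satisfiable
  tNAE⇔ = ⇔.trans (tNAE-attained bound≤N)
    (minSize⇔ (λ _ → All.map proj₁) standard-lower (witness-with proj₁) standard-extract)

  ts⇔ : TsIs F (M * 2) ⇔ Satisfiable
  ts⇔ = minSize⇔ (λ _ std → std) standard-lower (witness-with (All.map proj₁ ∘ proj₁)) standard-extract

  mfvs⇔ : MfvsIs (repGraph F) (M * 2) ⇔ Satisfiable
  mfvs⇔ = minSize⇔ (fvs⇒standard F F-distinct) standard-lower (witness-with (proj₁ ∘ proj₂)) standard-extract

  amfvs⇔ : AmfvsIs (repGraph F) (M * 2) ⇔ Satisfiable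
  amfvs⇔ = minSize⇔ (λ S → fvs⇒standard F F-distinct S ∘ proj₁) standard-lower (witness-with proj₂) standard-extract

two-fifths : ∀ M → (2 * (M * 5)) / 5 ≡ M * 2
two-fifths M = begin
  (2 * (M * 5)) / 5 ≡⟨ cong (_/ 5) (sym (*-assoc 2 M 5)) ⟩
  (2 * M * 5) / 5   ≡⟨ m*n/n≡m (2 * M) 5 ⟩
  2 * M             ≡⟨ *-comm 2 M ⟩
  M * 2             ∎
  where open ≡-Reasoning

claim10 : ∀ (n m : ℕ) (C : Vec (Clause3 n) m) →
    let F = MNAE C
        N = NU3 n m
        k = (2 * (N ∸ 1)) / 5
    in (TNAEIs F k ⇔ TsIs F k)
       × (TsIs F k ⇔ MfvsIs (repGraph F) k)
       × (MfvsIs (repGraph F) k ⇔ AmfvsIs (repGraph F) k)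
claim10 n m C rewrite two-fifths (n + m) = via tNAE⇔ ts⇔ , via ts⇔ mfvs⇔ , via mfvs⇔ amfvs⇔
  where open Reduction n m C
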